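{- Fix a variable $x$ and let $\chi$ be any formula generated by the grammar $\chi ::= p_x \mid \mathsf K_x\alpha \mid \neg\chi \mid (\chi\wedge\chi)$, where $p\in\mathbf P$ and $\alpha\in\mathcal L^{[:=]}_0$. Then for every sentence $\beta\in\mathcal L^{[:=]}_0$, $\vdash\mathsf K_\chi\beta\to\mathsf K_\chi\mathsf K_\chi\beta$, where $\vdash$ denotes provability in $\mathbf{LEL}^{[:=]}$.
   Context: Fix a nonempty finite set $\mathbf{A}$ of agents, a countable set $\mathbf{X}$ of variables with $\mathbf A\cap\mathbf X=\emptyset$, and a countable set $\mathbf{P}$ of predicate letters. Formulas of $\mathcal{L}^{[:=]}$ and free variables: $\phi ::= p_x \mid \top \mid \neg\phi \mid (\phi\wedge\phi) \mid [x:=a]\phi \mid \mathsf{K}_X\alpha$, with $p\in\mathbf P$, $x\in\mathbf X$, $a\in\mathbf A$, $X\subseteq\mathbf X$ finite (possibly empty), $\alpha$ a formula with no free variables (a sentence); $FV(p_x)=\{x\}$, $FV(\top)=\emptyset$, $FV$ commutes with Booleans, $FV([x:=a]\phi)=FV(\phi)\setminus\{x\}$, $FV(\mathsf K_X\alpha)=X$. $\mathcal L^{[:=]}_0$ is the set of sentences. Other Booleans as usual, $\bot:=\neg\top$, $\langle x:=a\rangle\phi:=\neg[x:=a]\neg\phi$. $\phi[y/x]$ replaces free occurrences of $x$ by $y$; admissible if $x$ has no free occurrence within the scope of any $[y:=b]$. For $\vec x=x_1,\dots,x_n$, $\vec a=a_1,\dots,a_n$: $[\vec x:=\vec a]\phi$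 abbreviates $[x_1:=a_1]\cdots[x_n:=a_n]\phi$, $\mathsf K_{\vec x}$ abbreviates $\mathsf K_{\{x_1,\dots,x_n\}}$, $\mathsf K_x=\mathsf K_{\{x\}}$. For a formula $\phi$ whose free variables are among $\{x\}$ and $A\subseteq\mathbf A$, $\phi!(A):=\bigwedge_{a\in A}\langle x:=a\rangle\phi\wedge\bigwedge_{b\in\mathbf A\setminus A}[x:=b]\neg\phi$, and $\mathsf K_\phi\alpha:=\bigwedge_{\{\vec a\}\subseteq\mathbf A}(\phi!(\{\vec a\})\to[\vec x:=\vec a]\mathsf K_{\vec x}\alpha)$, the conjunction ranging over all subsets $\{\vec a\}$ of $\mathbf A$ (each enumerated without repetition as $\vec a$, with $\vec x$ distinct variables of the same length). $\mathbf{LEL}^{[:=]}$: axioms: propositional tautologies; $\mathsf K_X(\alpha\to\beta)\to(\mathsf K_X\alpha\to\mathsf K_X\beta)$; $\mathsf K_X\alpha\to\mathsf K_Y\alpha$ ($X\subseteq Y$); $[x:=a](\phi\to\psi)\to([x:=a]\phi\to[x:=a]\psi)$; $\langle x:=a\rangle\phi\to[x:=a]\phi$; $\phi\to[x:=a]\phi$ ($x\notin FV(\phi)$); $[y:=a]([x:=a]\phi\to\phi[y/x])$ ($\phi[y/x]$ admissible); $[x:=a][y:=b]\phi\to[y:=b][x:=a]\phi$ ($x\neq y$); $\bigwedge_{a\in\mathbf A}[x:=a]\phi\to\phi$; $\mathsf K_X\alpha\to\alpha$; $[\vec x:=\vec a](\neg\mathsf K_{\vec x}\alpha\to\mathsf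 K_{\vec x}[\vec x:=\vec a]\neg\mathsf K_{\vec x}\alpha)$; $[x:=a]\mathsf K_x\langle x:=a\rangle\top$; $[x:=a](p_x\to\mathsf K_x[x:=a]p_x)$; $[\vec x:=\vec a](\bigwedge_{b\in B}[x:=b]\bot\to\mathsf K_{\vec x}\bigwedge_{b\in B}[x:=b]\bot)$ with $B=\mathbf A\setminus\{\vec a\}$. Rules: modus ponens; from $\alpha$ infer $\mathsf K_\emptyset\alpha$; from $\phi$ infer $[x:=a]\phi$. -}

module Defs where

open import Data.Nat using (ℕ; _≡ᵇ_)
open import Data.Bool using (Bool; true; false; if_then_else_; not; _∧_)
open import Data.Fin using (Fin)
import Data.Fin.Properties as FinP
open import Data.List using (List; []; _∷_; map; _++_; length; zip; upTo; filter; allFin)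
open import Data.List.Membership.Propositional using (_∈_)
import Data.List.Membership.DecPropositional as DecMem
open import Data.List.Relation.Unary.Unique.Propositional using (Unique)
open import Data.Product using (_×_; _,_; proj₁; proj₂)
open import Data.Empty using (⊥)
open import Data.Unit using (⊤)
open import Relation.Binary.PropositionalEquality using (_≡_)
open import Relation.Nullary using (¬_; ¬?)

module LEL (n : ℕ) where

  Agent : Set
  Agent = Fin (ℕ.suc n)

  Var : Set
  Var = ℕ

  Pred : Set
  Pred = ℕ

  -- Raw syntax.  'K X α' is the knowledge operator K_X α; finite sets of
  -- variables X are represented by lists (with set semantics: see FreeIn and
  -- the monotonicity axiom).  Only formulas satisfying WF (below), i.e. whose
  -- K-bodies are sentences, are formulas of L^[:=].
  data Fm : Set where
    P    : Pred → Var → Fm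
    tt   : Fm
    ¬'_  : Fm → Fm
    _∧'_ : Fm → Fm → Fm
    [_≔_]_ : Var → Agent → Fm → Fm
    K    : List Var → Fm → Fm

  infixr 6 _∧'_
  infixr 4 _⇒_
  infix 7 ¬'_

  ff : Fm
  ff = ¬' tt

  _⇒_ : Fm → Fm → Fm
  φ ⇒ ψ = ¬' (φ ∧' ¬' ψ)

  ⟨_≔_⟩_ : Var → Agent → Fm → Fm
  ⟨ x ≔ a ⟩ φ = ¬' ([ x ≔ a ] (¬' φ))

  ⋀ : List Fm → Fm
  ⋀ [] = tt
  ⋀ (φ ∷ φs) = φ ∧' ⋀ φs

  data FreeIn (x : Var) : Fm → Set where
    fP   : ∀ {p} → FreeIn x (P p x)
    f¬   : ∀ {φ} → FreeIn x φ → FreeIn x (¬' φ)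
    f∧l  : ∀ {φ ψ} → FreeIn x φ → FreeIn x (φ ∧' ψ)
    f∧r  : ∀ {φ ψ} → FreeIn x ψ → FreeIn x (φ ∧' ψ)
    f≔   : ∀ {y a φ} → ¬ (x ≡ y) → FreeIn x φ → FreeIn x ([ y ≔ a ] φ)
    fK   : ∀ {X α} → x ∈ X → FreeIn x (K X α)

  Closed : Fm → Set
  Closed φ = ∀ x → ¬ FreeIn x φ

  data WF : Fm → Set where
    wP  : ∀ {p x} → WF (P p x)
    wtt : WF tt
    w¬  : ∀ {φ} → WF φ → WF (¬' φ)
    w∧  : ∀ {φ ψ} → WF φ → WF ψ → WF (φ ∧' ψ)
    w≔  : ∀ {x a φ} → WF φ → WF ([ x ≔ a ] φ)
    wK  : ∀ {X α} → WF α → Closed α → WF (K X α)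

  rn : Var → Var → Var → Var
  rn y x z = if z ≡ᵇ x then y else z

  sub : Var → Var → Fm → Fm
  sub y x (P p z) = P p (rn y x z)
  sub y x tt = tt
  sub y x (¬' φ) = ¬' sub y x φ
  sub y x (φ ∧' ψ) = sub y x φ ∧' sub y x ψ
  sub y x ([ z ≔ a ] φ) = if z ≡ᵇ x then [ z ≔ a ] φ else [ z ≔ a ] sub y x φ
  sub y x (K X α) = K (map (rn y x) X) α

  Adm : Var → Var → Fm → Set
  Adm y x (P p z) = ⊤
  Adm y x tt = ⊤
  Adm y x (¬' φ) = Adm y x φ
  Adm y x (φ ∧' ψ) = Adm y x φ × Adm y x ψ
  Adm y x ([ z ≔ b ] φ) =
    if z ≡ᵇ x then ⊤ else ((z ≡ y → ¬ FreeIn x φ) × Adm y x φ)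
  Adm y x (K X α) = ⊤

  assign : List (Var × Agent) → Fm → Fm
  assign [] φ = φ
  assign ((x , a) ∷ xs) φ = [ x ≔ a ] assign xs φ

  vars : List (Var × Agent) → List Var
  vars = map proj₁

  agents : List (Var × Agent) → List Agent
  agents = map proj₂

  allAgents : List Agent
  allAgents = allFin (ℕ.suc n)

  compl : List Agent → List Agent
  compl as = filter (λ b → ¬? (DecMem._∈?_ (FinP._≟_ {ℕ.suc n}) b as)) allAgents

  -- propositional tautologies: true under every Boolean valuation of the
  -- non-Boolean subformulas (p_x, [x:=a]φ, K_X α)
  eval : (Fm → Bool) → Fm → Bool
  eval v tt = true
  eval v (¬' φ) = not (eval v φ)
  eval v (φ ∧' ψ) = eval v φ ∧ eval v ψ
  eval v φ = v φ

  Taut : Fm → Set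
  Taut φ = ∀ v → eval v φ ≡ true

  _⊆_ : List Var → List Var → Set
  X ⊆ Y = ∀ {z} → z ∈ X → z ∈ Y

  data Axiom : Fm → Set where
    ax-taut  : ∀ {φ} → Taut φ → Axiom φ
    ax-KK    : ∀ {X α β} → Axiom (K X (α ⇒ β) ⇒ (K X α ⇒ K X β))
    ax-mono  : ∀ {X Y α} → X ⊆ Y → Axiom (K X α ⇒ K Y α)
    ax-K≔    : ∀ {x a φ ψ} →
               Axiom ([ x ≔ a ] (φ ⇒ ψ) ⇒ ([ x ≔ a ] φ ⇒ [ x ≔ a ] ψ))
    ax-func  : ∀ {x a φ} → Axiom (⟨ x ≔ a ⟩ φ ⇒ [ x ≔ a ] φ)
    ax-vac   : ∀ {x a φ} → ¬ FreeIn x φ → Axiom (φ ⇒ [ x ≔ a ] φ)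
    ax-sub   : ∀ {x y a φ} → Adm y x φ →
               Axiom ([ y ≔ a ] ([ x ≔ a ] φ ⇒ sub y x φ))
    ax-comm  : ∀ {x y a b φ} → ¬ (x ≡ y) →
               Axiom ([ x ≔ a ] [ y ≔ b ] φ ⇒ [ y ≔ b ] [ x ≔ a ] φ)
    ax-all   : ∀ {x φ} → Axiom (⋀ (map (λ a → [ x ≔ a ] φ) allAgents) ⇒ φ)
    ax-T     : ∀ {X α} → Axiom (K X α ⇒ α)
    ax-neg   : ∀ {xs : List (Var × Agent)} {α} → Unique (vars xs) →
               Axiom (assign xs (¬' K (vars xs) α ⇒
                        K (vars xs) (assign xs (¬' K (vars xs) α))))
    ax-ex    : ∀ {x a} → Axiom ([ x ≔ a ] K (x ∷ []) (⟨ x ≔ a ⟩ tt))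
    ax-atom  : ∀ {x a p} →
               Axiom ([ x ≔ a ] (P p x ⇒ K (x ∷ []) ([ x ≔ a ] P p x)))
    ax-dom   : ∀ {xs : List (Var × Agent)} {x} → Unique (vars xs) →
               Axiom (assign xs
                 (⋀ (map (λ b → [ x ≔ b ] ff) (compl (agents xs)))
                  ⇒ K (vars xs) (⋀ (map (λ b → [ x ≔ b ] ff) (compl (agents xs))))))

  -- provability in LEL^[:=] (only well-formed formulas are derivable)
  data ⊢_ : Fm → Set where
    ax  : ∀ {φ} → Axiom φ → WF φ → ⊢ φ
    mp  : ∀ {φ ψ} → ⊢ (φ ⇒ ψ) → ⊢ φ → ⊢ ψ
    nec : ∀ {α} → Closed α → ⊢ α → ⊢ K [] α
    gen : ∀ {x a φ} → ⊢ φ → ⊢ [ x ≔ a ] φ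

  -- all subsets S of A, each paired with its complement A ∖ S;
  -- S is enumerated in increasing order without repetition
  splits : {A : Set} → List A → List (List A × List A)
  splits [] = ([] , []) ∷ []
  splits (a ∷ as) =
    map (λ p → (a ∷ proj₁ p , proj₂ p)) (splits as) ++
    map (λ p → (proj₁ p , a ∷ proj₂ p)) (splits as)

  bang : Var → Fm → List Agent → List Agent → Fm
  bang x φ S B = ⋀ (map (λ a → ⟨ x ≔ a ⟩ φ) S) ∧' ⋀ (map (λ b → [ x ≔ b ] (¬' φ)) B)

  -- K_φ α, with the distinct variables x⃗ = 0,1,...,|S|-1
  Kφ : Var → Fm → Fm → Fm
  Kφ x φ α = ⋀ (map clause (splits allAgents))
    where
    clause : List Agent × List Agent → Fm
    clause (S , B) =
      let xs = zip (upTo (length S)) S in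
      bang x φ S B ⇒ assign xs (K (vars xs) α)

  data IsChi (x : Var) : Fm → Set where
    χP : ∀ {p} → IsChi x (P p x)
    χK : ∀ {α} → WF α → Closed α → IsChi x (K (x ∷ []) α)
    χ¬ : ∀ {χ} → IsChi x χ → IsChi x (¬' χ)
    χ∧ : ∀ {χ χ'} → IsChi x χ → IsChi x χ' → IsChi x (χ ∧' χ')

module Submission where

-- For one clause of K_χ K_χ β assume K_χ β and χ!(S,B), which give ⋀_{a∈S} ⟨x:=a⟩χ and
-- [x⃗:=S] K_x⃗ β.  Every χ-formula is introspective, [x:=a](χ → K_x [x:=a]χ): for atoms and K_x α
-- this is an axiom resp. positive introspection, and ¬, ∧ preserve it.  Hence both facts are known
-- under [x⃗:=S], and together they imply K_χ β: for a split (S', B') either S ⊑ S', and renaming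
-- bound variables turns [x⃗:=S] K_x⃗ β into [x⃗:=S'] K_x⃗ β, or some a ∈ S lies in B', so that
-- χ!(S',B') contradicts ⟨x:=a⟩χ.  Knowing K_χ β under [x⃗:=S] is the clause.

open import Defs
open import Data.Nat using (ℕ; zero; suc; _+_; _<_; _≤_; _≡ᵇ_; _<?_; s≤s; z≤n)
open import Data.Bool using (Bool; true; false; not; _∧_; T)
open import Data.Bool.Properties using (T-≡; T-∧)
open import Data.Nat.Properties
  using (≡ᵇ⇒≡; ≡⇒≡ᵇ; +-suc; +-identityʳ; m≤m+n; <-irrefl; ≤-<-trans; <-≤-trans; <-trans; m≤n⇒m<n∨m≡n;
         m<n⇒m<1+n; n<1+n; <-cmp; <⇒≢; ≤-pred)
open import Relation.Binary.Definitions using (tri<; tri≈; tri>)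
open import Data.Fin using (Fin) renaming (zero to fzero; suc to fsuc)
open import Data.Vec using (Vec; []; _∷_; lookup)
import Data.Vec as Vec
open import Data.Vec.Properties using (lookup-map)
open import Data.List using (List; []; _∷_; map; length; zip; applyUpTo; upTo)
open import Data.List.Membership.Propositional using (_∈_)
open import Data.List.Membership.Propositional.Properties using (∈-map⁺; ∈-map⁻; ∈-++⁻)
open import Data.List.Properties using (map-∘; map-cong)
open import Data.List.Relation.Binary.Sublist.Propositional using ([]; _∷_; _∷ʳ_; from∈) renaming (_⊆_ to _⊑_)
open import Data.List.Relation.Unary.Any using (here; there)
open import Data.Product using (_×_; _,_; proj₁; proj₂; ∃)
open import Data.Empty using (⊥-elim)
open import Relation.Nullary using (¬_; yes; no)
open import Data.List.Relation.Unary.Unique.Propositional using (Unique)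
open import Data.List.Relation.Unary.AllPairs using ([]; _∷_)
open import Data.List.Relation.Unary.All using (All; []; _∷_)
import Data.List.Relation.Unary.All as All
open import Data.Sum using (_⊎_; inj₁; inj₂)
open import Function using (Equivalence)
open import Relation.Binary.PropositionalEquality using (_≡_; _≢_; refl; sym; trans; cong; cong₂; subst)

module _ (n : ℕ) where
  open LEL n

  -- Propositional tautologies

  infix 7 ¬ᵖ_
  infixr 6 _∧ᵖ_
  infixr 4 _⇒ᵖ_

  data Prop (k : ℕ) : Set where
    atom : Fin k → Prop k
    ¬ᵖ_  : Prop k → Prop k
    _∧ᵖ_ : Prop k → Prop k → Prop k

  _⇒ᵖ_ : ∀ {k} → Prop k → Prop k → Prop k
  φ ⇒ᵖ ψ = ¬ᵖ (φ ∧ᵖ ¬ᵖ ψ)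

  p₀ : ∀ {k} → Prop (1 + k)
  p₀ = atom fzero
  p₁ : ∀ {k} → Prop (2 + k)
  p₁ = atom (fsuc fzero)
  p₂ : ∀ {k} → Prop (3 + k)
  p₂ = atom (fsuc (fsuc fzero))
  p₃ : ∀ {k} → Prop (4 + k)
  p₃ = atom (fsuc (fsuc (fsuc fzero)))
  p₄ : ∀ {k} → Prop (5 + k)
  p₄ = atom (fsuc (fsuc (fsuc (fsuc fzero))))

  ⟦_⟧ : ∀ {k} → Prop k → Vec Fm k → Fm
  ⟦ atom i ⟧ ρ = lookup ρ i
  ⟦ ¬ᵖ φ ⟧ ρ = ¬' ⟦ φ ⟧ ρ
  ⟦ φ ∧ᵖ ψ ⟧ ρ = ⟦ φ ⟧ ρ ∧' ⟦ ψ ⟧ ρ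

  ⟦_⟧ᵇ : ∀ {k} → Prop k → Vec Bool k → Bool
  ⟦ atom i ⟧ᵇ v = lookup v i
  ⟦ ¬ᵖ φ ⟧ᵇ v = not (⟦ φ ⟧ᵇ v)
  ⟦ φ ∧ᵖ ψ ⟧ᵇ v = ⟦ φ ⟧ᵇ v ∧ ⟦ ψ ⟧ᵇ v

  eval-⟦⟧ : ∀ {k} w (φ : Prop k) ρ → eval w (⟦ φ ⟧ ρ) ≡ ⟦ φ ⟧ᵇ (Vec.map (eval w) ρ)
  eval-⟦⟧ w (atom i) ρ = sym (lookup-map i (eval w) ρ)
  eval-⟦⟧ w (¬ᵖ φ) ρ = cong not (eval-⟦⟧ w φ ρ)
  eval-⟦⟧ w (φ ∧ᵖ ψ) ρ = cong₂ _∧_ (eval-⟦⟧ w φ ρ) (eval-⟦⟧ w ψ ρ)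

  allValuations : ∀ k → (Vec Bool k → Bool) → Bool
  allValuations zero f = f []
  allValuations (suc k) f = allValuations k (λ v → f (true ∷ v)) ∧ allValuations k (λ v → f (false ∷ v))

  allValuations-sound : ∀ k f → T (allValuations k f) → ∀ v → T (f v)
  allValuations-sound zero f ok [] = ok
  allValuations-sound (suc k) f ok (true ∷ v) =
    allValuations-sound k _ (proj₁ (Equivalence.to T-∧ ok)) v
  allValuations-sound (suc k) f ok (false ∷ v) =
    allValuations-sound k _ (proj₂ (Equivalence.to T-∧ ok)) v

  Valid : ∀ {k} → Prop k → Set
  Valid {k} φ = T (allValuations k ⟦ φ ⟧ᵇ)

  -- When φ is a tautology, Valid φ normalises to ⊤ and the implicit argument is inferred.
  tautology : ∀ {k} (φ : Prop k) ρ {_ : Valid φ} → WF (⟦ φ ⟧ ρ) → ⊢ ⟦ φ ⟧ ρ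
  tautology {k} φ ρ {valid} wf = ax (ax-taut taut) wf
    where
    taut : Taut (⟦ φ ⟧ ρ)
    taut w = trans (eval-⟦⟧ w φ ρ)
      (Equivalence.to T-≡ (allValuations-sound k ⟦ φ ⟧ᵇ valid (Vec.map (eval w) ρ)))

  wf-⇒ : ∀ {φ ψ} → WF φ → WF ψ → WF (φ ⇒ ψ)
  wf-⇒ wφ wψ = w¬ (w∧ wφ (w¬ wψ))

  wf-⇒⁻ : ∀ {φ ψ} → WF (φ ⇒ ψ) → WF φ × WF ψ
  wf-⇒⁻ (w¬ (w∧ wφ (w¬ wψ))) = wφ , wψ

  ⊢⇒wf : ∀ {φ} → ⊢ φ → WF φ
  ⊢⇒wf (ax _ wf) = wf
  ⊢⇒wf (mp d _) = proj₂ (wf-⇒⁻ (⊢⇒wf d))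
  ⊢⇒wf (nec cl d) = wK (⊢⇒wf d) cl
  ⊢⇒wf (gen d) = w≔ (⊢⇒wf d)

  wf-antecedent : ∀ {φ ψ} → ⊢ (φ ⇒ ψ) → WF φ
  wf-antecedent d = proj₁ (wf-⇒⁻ (⊢⇒wf d))

  wf-consequent : ∀ {φ ψ} → ⊢ (φ ⇒ ψ) → WF ψ
  wf-consequent d = proj₂ (wf-⇒⁻ (⊢⇒wf d))

  taut₁ : ∀ {k} (φ ψ : Prop k) ρ {_ : Valid (φ ⇒ᵖ ψ)} →
          WF (⟦ ψ ⟧ ρ) → ⊢ ⟦ φ ⟧ ρ → ⊢ ⟦ ψ ⟧ ρ
  taut₁ φ ψ ρ {valid} wψ d = mp (tautology (φ ⇒ᵖ ψ) ρ {valid} (wf-⇒ (⊢⇒wf d) wψ)) d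

  taut₂ : ∀ {k} (φ ψ θ : Prop k) ρ {_ : Valid (φ ⇒ᵖ ψ ⇒ᵖ θ)} →
          WF (⟦ θ ⟧ ρ) → ⊢ ⟦ φ ⟧ ρ → ⊢ ⟦ ψ ⟧ ρ → ⊢ ⟦ θ ⟧ ρ
  taut₂ φ ψ θ ρ {valid} wθ d e =
    mp (mp (tautology (φ ⇒ᵖ ψ ⇒ᵖ θ) ρ {valid} (wf-⇒ (⊢⇒wf d) (wf-⇒ (⊢⇒wf e) wθ))) d) e

  taut₃ : ∀ {k} (φ ψ θ χ : Prop k) ρ {_ : Valid (φ ⇒ᵖ ψ ⇒ᵖ θ ⇒ᵖ χ)} →
          WF (⟦ χ ⟧ ρ) → ⊢ ⟦ φ ⟧ ρ → ⊢ ⟦ ψ ⟧ ρ → ⊢ ⟦ θ ⟧ ρ → ⊢ ⟦ χ ⟧ ρ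
  taut₃ φ ψ θ χ ρ {valid} wχ d e f =
    mp (mp (mp (tautology (φ ⇒ᵖ ψ ⇒ᵖ θ ⇒ᵖ χ) ρ {valid} wf) d) e) f
    where
    wf : WF (⟦ φ ⇒ᵖ ψ ⇒ᵖ θ ⇒ᵖ χ ⟧ ρ)
    wf = wf-⇒ (⊢⇒wf d) (wf-⇒ (⊢⇒wf e) (wf-⇒ (⊢⇒wf f) wχ))

  ⇒-trans : ∀ {A B C} → ⊢ (A ⇒ B) → ⊢ (B ⇒ C) → ⊢ (A ⇒ C)
  ⇒-trans {A} {B} {C} d e = taut₂ (p₀ ⇒ᵖ p₁) (p₁ ⇒ᵖ p₂) (p₀ ⇒ᵖ p₂) (A ∷ B ∷ C ∷ [])
    (wf-⇒ (wf-antecedent d) (wf-consequent e)) d e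

  ⇒-refl : ∀ {A} → WF A → ⊢ (A ⇒ A)
  ⇒-refl {A} wA = tautology (p₀ ⇒ᵖ p₀) (A ∷ []) (wf-⇒ wA wA)

  ⇒-weaken : ∀ {A B} → WF B → ⊢ A → ⊢ (B ⇒ A)
  ⇒-weaken {A} {B} wB d = taut₁ p₀ (p₁ ⇒ᵖ p₀) (A ∷ B ∷ []) (wf-⇒ wB (⊢⇒wf d)) d

  ∧-projˡ : ∀ {A B} → WF A → WF B → ⊢ ((A ∧' B) ⇒ A)
  ∧-projˡ {A} {B} wA wB = tautology (p₀ ∧ᵖ p₁ ⇒ᵖ p₀) (A ∷ B ∷ []) (wf-⇒ (w∧ wA wB) wA)

  ∧-projʳ : ∀ {A B} → WF A → WF B → ⊢ ((A ∧' B) ⇒ B)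
  ∧-projʳ {A} {B} wA wB = tautology (p₀ ∧ᵖ p₁ ⇒ᵖ p₁) (A ∷ B ∷ []) (wf-⇒ (w∧ wA wB) wB)

  ⇒-∧-intro : ∀ {A B C} → ⊢ (C ⇒ A) → ⊢ (C ⇒ B) → ⊢ (C ⇒ (A ∧' B))
  ⇒-∧-intro {A} {B} {C} d e =
    taut₂ (p₂ ⇒ᵖ p₀) (p₂ ⇒ᵖ p₁) (p₂ ⇒ᵖ p₀ ∧ᵖ p₁) (A ∷ B ∷ C ∷ [])
      (wf-⇒ (wf-antecedent d) (w∧ (wf-consequent d) (wf-consequent e))) d e

  ⊢tt : ⊢ tt
  ⊢tt = ax (ax-taut (λ _ → refl)) wtt

  ⇒-mp : ∀ {A B C} → ⊢ (A ⇒ (B ⇒ C)) → ⊢ B → ⊢ (A ⇒ C)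
  ⇒-mp {A} {B} {C} d e =
    taut₂ (p₀ ⇒ᵖ p₁ ⇒ᵖ p₂) p₁ (p₀ ⇒ᵖ p₂) (A ∷ B ∷ C ∷ [])
      (wf-⇒ (wf-antecedent d) (proj₂ (wf-⇒⁻ (wf-consequent d)))) d e

  -- Assignments and knowledge as normal modalities

  FreeVars⊆ : Fm → List Var → Set
  FreeVars⊆ φ X = ∀ y → FreeIn y φ → y ∈ X

  closed-tt : Closed tt
  closed-tt _ ()

  closed-¬ : ∀ {φ} → Closed φ → Closed (¬' φ)
  closed-¬ cφ y (f¬ p) = cφ y p

  closed-∧ : ∀ {φ ψ} → Closed φ → Closed ψ → Closed (φ ∧' ψ)
  closed-∧ cφ cψ y (f∧l p) = cφ y p
  closed-∧ cφ cψ y (f∧r p) = cψ y p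

  closed-⇒ : ∀ {φ ψ} → Closed φ → Closed ψ → Closed (φ ⇒ ψ)
  closed-⇒ cφ cψ = closed-¬ (closed-∧ cφ (closed-¬ cψ))

  wf-assign : ∀ xs {φ} → WF φ → WF (assign xs φ)
  wf-assign [] wφ = wφ
  wf-assign (_ ∷ xs) wφ = w≔ (wf-assign xs wφ)

  wf-assign⁻ : ∀ xs {φ} → WF (assign xs φ) → WF φ
  wf-assign⁻ [] wφ = wφ
  wf-assign⁻ (_ ∷ xs) (w≔ wφ) = wf-assign⁻ xs wφ

  free-assign⁻ : ∀ xs {y φ} → FreeIn y (assign xs φ) → FreeIn y φ × ¬ y ∈ vars xs
  free-assign⁻ [] p = p , λ ()
  free-assign⁻ (_ ∷ xs) (f≔ y≢z p) with free-assign⁻ xs p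
  ... | q , y∉xs = q , λ { (here y≡z) → y≢z y≡z ; (there y∈xs) → y∉xs y∈xs }

  closed-assign : ∀ xs {φ} → FreeVars⊆ φ (vars xs) → Closed (assign xs φ)
  closed-assign xs fv y p with free-assign⁻ xs p
  ... | q , y∉xs = y∉xs (fv y q)

  closed-assign-K : ∀ xs {α} → Closed α → Closed (assign xs (K (vars xs) α))
  closed-assign-K xs cα = closed-assign xs λ { y (fK y∈xs) → y∈xs }

  assign-gen : ∀ xs {φ} → ⊢ φ → ⊢ assign xs φ
  assign-gen [] d = d
  assign-gen (_ ∷ xs) d = gen (assign-gen xs d)

  assign-distrib : ∀ xs {φ ψ} → WF φ → WF ψ →
                   ⊢ (assign xs (φ ⇒ ψ) ⇒ (assign xs φ ⇒ assign xs ψ))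
  assign-distrib [] wφ wψ = ⇒-refl (wf-⇒ wφ wψ)
  assign-distrib ((y , a) ∷ xs) wφ wψ =
    ⇒-trans (mp (distrib₁ (wf-assign xs (wf-⇒ wφ wψ)) (wf-⇒ (wf-assign xs wφ) (wf-assign xs wψ)))
                (gen (assign-distrib xs wφ wψ)))
            (distrib₁ (wf-assign xs wφ) (wf-assign xs wψ))
    where
    distrib₁ : ∀ {φ ψ} → WF φ → WF ψ → ⊢ ([ y ≔ a ] (φ ⇒ ψ) ⇒ ([ y ≔ a ] φ ⇒ [ y ≔ a ] ψ))
    distrib₁ wφ wψ = ax ax-K≔ (wf-⇒ (w≔ (wf-⇒ wφ wψ)) (wf-⇒ (w≔ wφ) (w≔ wψ)))

  assign-⇒-distrib : ∀ xs {φ ψ} → ⊢ assign xs (φ ⇒ ψ) → ⊢ (assign xs φ ⇒ assign xs ψ)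
  assign-⇒-distrib xs d with wf-⇒⁻ (wf-assign⁻ xs (⊢⇒wf d))
  ... | wφ , wψ = mp (assign-distrib xs wφ wψ) d

  assign-mp : ∀ xs {φ ψ} → ⊢ assign xs (φ ⇒ ψ) → ⊢ assign xs φ → ⊢ assign xs ψ
  assign-mp xs d = mp (assign-⇒-distrib xs d)

  assign-mono : ∀ xs {φ ψ} → ⊢ (φ ⇒ ψ) → ⊢ (assign xs φ ⇒ assign xs ψ)
  assign-mono xs d = assign-⇒-distrib xs (assign-gen xs d)

  assign-mono₂ : ∀ xs {φ ψ θ} → ⊢ (φ ⇒ (ψ ⇒ θ)) → ⊢ (assign xs φ ⇒ (assign xs ψ ⇒ assign xs θ))
  assign-mono₂ xs d with wf-⇒⁻ (wf-consequent d)
  ... | wψ , wθ = ⇒-trans (assign-mono xs d) (assign-distrib xs wψ wθ)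

  assign-taut₁ : ∀ xs {k} (φ ψ : Prop k) ρ {_ : Valid (φ ⇒ᵖ ψ)} →
                 WF (⟦ ψ ⟧ ρ) → ⊢ assign xs (⟦ φ ⟧ ρ) → ⊢ assign xs (⟦ ψ ⟧ ρ)
  assign-taut₁ xs φ ψ ρ {valid} wψ d =
    assign-mp xs (assign-gen xs (tautology (φ ⇒ᵖ ψ) ρ {valid} (wf-⇒ (wf-assign⁻ xs (⊢⇒wf d)) wψ))) d

  assign-taut₂ : ∀ xs {k} (φ ψ θ : Prop k) ρ {_ : Valid (φ ⇒ᵖ ψ ⇒ᵖ θ)} →
                 WF (⟦ θ ⟧ ρ) → ⊢ assign xs (⟦ φ ⟧ ρ) → ⊢ assign xs (⟦ ψ ⟧ ρ) → ⊢ assign xs (⟦ θ ⟧ ρ)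
  assign-taut₂ xs φ ψ θ ρ {valid} wθ d e =
    assign-mp xs (assign-mp xs (assign-gen xs (tautology (φ ⇒ᵖ ψ ⇒ᵖ θ) ρ {valid} wf)) d) e
    where
    wf : WF (⟦ φ ⇒ᵖ ψ ⇒ᵖ θ ⟧ ρ)
    wf = wf-⇒ (wf-assign⁻ xs (⊢⇒wf d)) (wf-⇒ (wf-assign⁻ xs (⊢⇒wf e)) wθ)

  assign-⇒-trans : ∀ xs {A B C} → ⊢ assign xs (A ⇒ B) → ⊢ assign xs (B ⇒ C) → ⊢ assign xs (A ⇒ C)
  assign-⇒-trans xs {A} {B} {C} d e with wf-⇒⁻ (wf-assign⁻ xs (⊢⇒wf d)) | wf-⇒⁻ (wf-assign⁻ xs (⊢⇒wf e))
  ... | wA , _ | _ , wC =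
    assign-taut₂ xs (p₀ ⇒ᵖ p₁) (p₁ ⇒ᵖ p₂) (p₀ ⇒ᵖ p₂) (A ∷ B ∷ C ∷ []) (wf-⇒ wA wC) d e

  assign-contrapose : ∀ xs {A B} → ⊢ assign xs (A ⇒ B) → ⊢ assign xs (¬' B ⇒ ¬' A)
  assign-contrapose xs {A} {B} d with wf-⇒⁻ (wf-assign⁻ xs (⊢⇒wf d))
  ... | wA , wB = assign-taut₁ xs (p₀ ⇒ᵖ p₁) (¬ᵖ p₁ ⇒ᵖ ¬ᵖ p₀) (A ∷ B ∷ []) (wf-⇒ (w¬ wB) (w¬ wA)) d

  vacuous : ∀ {y a φ} → ¬ FreeIn y φ → WF φ → ⊢ (φ ⇒ [ y ≔ a ] φ)
  vacuous y∉φ wφ = ax (ax-vac y∉φ) (wf-⇒ wφ (w≔ wφ))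

  assign-vacuous : ∀ xs {φ} → Closed φ → WF φ → ⊢ (φ ⇒ assign xs φ)
  assign-vacuous [] cφ wφ = ⇒-refl wφ
  assign-vacuous ((y , a) ∷ xs) cφ wφ =
    ⇒-trans (assign-vacuous xs cφ wφ)
            (vacuous (closed-assign xs (λ z p → ⊥-elim (cφ z p)) y) (wf-assign xs wφ))

  ≡ᵇ-true : ∀ {m k} → (m ≡ᵇ k) ≡ true → m ≡ k
  ≡ᵇ-true {m} {k} eq = ≡ᵇ⇒≡ m k (subst T (sym eq) _)

  ≡ᵇ-false : ∀ {m k} → (m ≡ᵇ k) ≡ false → m ≢ k
  ≡ᵇ-false {m} {k} eq m≡k = subst T eq (≡⇒≡ᵇ m k m≡k)

  rn-self : ∀ y z → rn y y z ≡ z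
  rn-self y z with z ≡ᵇ y in eq
  ... | true = sym (≡ᵇ-true eq)
  ... | false = refl

  rn-hit : ∀ y x → rn y x x ≡ y
  rn-hit y x with x ≡ᵇ x in eq
  ... | true = refl
  ... | false = ⊥-elim (≡ᵇ-false {x} eq refl)

  rn-miss : ∀ y x z → z ≢ x → rn y x z ≡ z
  rn-miss y x z z≢x with z ≡ᵇ x in eq
  ... | true = ⊥-elim (z≢x (≡ᵇ-true eq))
  ... | false = refl

  sub-self : ∀ y φ → sub y y φ ≡ φ
  sub-self y (P p z) = cong (P p) (rn-self y z)
  sub-self y tt = refl
  sub-self y (¬' φ) = cong ¬'_ (sub-self y φ)
  sub-self y (φ ∧' ψ) = cong₂ _∧'_ (sub-self y φ) (sub-self y ψ)
  sub-self y ([ z ≔ a ] φ) with z ≡ᵇ y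
  ... | true = refl
  ... | false = cong [ z ≔ a ]_ (sub-self y φ)
  sub-self y (K X α) = cong (λ X → K X α) (map-self X)
    where
    map-self : ∀ X → map (rn y y) X ≡ X
    map-self [] = refl
    map-self (z ∷ X) = cong₂ _∷_ (rn-self y z) (map-self X)

  adm-self : ∀ y φ → Adm y y φ
  adm-self y (P p z) = _
  adm-self y tt = _
  adm-self y (¬' φ) = adm-self y φ
  adm-self y (φ ∧' ψ) = adm-self y φ , adm-self y ψ
  adm-self y ([ z ≔ a ] φ) with z ≡ᵇ y in eq
  ... | true = _
  ... | false = (λ z≡y → ⊥-elim (≡ᵇ-false eq z≡y)) , adm-self y φ
  adm-self y (K X α) = _

  wf-sub : ∀ y x {φ} → WF φ → WF (sub y x φ)
  wf-sub y x wP = wP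
  wf-sub y x wtt = wtt
  wf-sub y x (w¬ wφ) = w¬ (wf-sub y x wφ)
  wf-sub y x (w∧ wφ wψ) = w∧ (wf-sub y x wφ) (wf-sub y x wψ)
  wf-sub y x (w≔ {z} wφ) with z ≡ᵇ x
  ... | true = w≔ wφ
  ... | false = w≔ (wf-sub y x wφ)
  wf-sub y x (wK wα cα) = wK wα cα

  substitution : ∀ {x y a φ} → Adm y x φ → WF φ → ⊢ [ y ≔ a ] ([ x ≔ a ] φ ⇒ sub y x φ)
  substitution {x} {y} adm wφ = ax (ax-sub adm) (w≔ (wf-⇒ (w≔ wφ) (wf-sub y x wφ)))

  assign-⇒-closed : ∀ ys {c θ} → Closed c → WF c → WF θ →
                    ⊢ ((c ⇒ assign ys θ) ⇒ assign ys (c ⇒ θ))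
  assign-⇒-closed ys {c} {θ} cc wc wθ =
    taut₂ (p₀ ⇒ᵖ p₁) (¬ᵖ p₂ ⇒ᵖ p₁) ((p₂ ⇒ᵖ p₀) ⇒ᵖ p₁)
      (assign ys θ ∷ assign ys (c ⇒ θ) ∷ c ∷ [])
      (wf-⇒ (wf-⇒ wc (wf-assign ys wθ)) (wf-assign ys (wf-⇒ wc wθ)))
      (assign-mono ys (tautology (p₀ ⇒ᵖ p₁ ⇒ᵖ p₀) (θ ∷ c ∷ []) (wf-⇒ wθ (wf-⇒ wc wθ))))
      (⇒-trans (assign-vacuous ys (closed-¬ cc) (w¬ wc))
               (assign-mono ys (tautology (¬ᵖ p₀ ⇒ᵖ p₀ ⇒ᵖ p₁) (c ∷ θ ∷ [])
                                  (wf-⇒ (w¬ wc) (wf-⇒ wc wθ)))))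

  -- The substitution axiom with y = x, moved under the remaining assignments by closedness.
  assign-T : ∀ xs {φ} → Closed (assign xs φ) → WF φ → ⊢ assign xs (assign xs φ ⇒ φ)
  assign-T [] cφ wφ = ⇒-refl wφ
  assign-T ((y , a) ∷ ys) {φ} cφ wφ =
    mp (assign-mono ((y , a) ∷ []) (assign-⇒-closed ys cφ (wf-assign ((y , a) ∷ ys) wφ) wφ))
       (subst (λ ψ → ⊢ [ y ≔ a ] ([ y ≔ a ] assign ys φ ⇒ ψ)) (sub-self y (assign ys φ))
              (substitution (adm-self y (assign ys φ)) (wf-assign ys wφ)))

  K-⊆ : ∀ {X Y α} → X ⊆ Y → WF α → Closed α → ⊢ (K X α ⇒ K Y α)
  K-⊆ X⊆Y wα cα = ax (ax-mono X⊆Y) (wf-⇒ (wK wα cα) (wK wα cα))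

  K-nec : ∀ X {α} → Closed α → ⊢ α → ⊢ K X α
  K-nec X cα d = mp (K-⊆ (λ ()) (⊢⇒wf d) cα) (nec cα d)

  K-T : ∀ {X α} → WF α → Closed α → ⊢ (K X α ⇒ α)
  K-T wα cα = ax ax-T (wf-⇒ (wK wα cα) wα)

  K-distrib : ∀ X {α β} → Closed α → Closed β → WF α → WF β →
              ⊢ (K X (α ⇒ β) ⇒ (K X α ⇒ K X β))
  K-distrib X cα cβ wα wβ =
    ax ax-KK (wf-⇒ (wK (wf-⇒ wα wβ) (closed-⇒ cα cβ)) (wf-⇒ (wK wα cα) (wK wβ cβ)))

  K-mono : ∀ X {α β} → Closed α → Closed β → ⊢ (α ⇒ β) → ⊢ (K X α ⇒ K X β)
  K-mono X cα cβ d =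
    mp (K-distrib X cα cβ (wf-antecedent d) (wf-consequent d)) (K-nec X (closed-⇒ cα cβ) d)

  K-mono₂ : ∀ X {α β γ} → Closed α → Closed β → Closed γ → ⊢ (α ⇒ (β ⇒ γ)) →
            ⊢ (K X α ⇒ (K X β ⇒ K X γ))
  K-mono₂ X cα cβ cγ d with wf-⇒⁻ (wf-consequent d)
  ... | wβ , wγ = ⇒-trans (K-mono X cα (closed-⇒ cβ cγ) d) (K-distrib X cβ cγ wβ wγ)

  -- Introspective formulas

  Introspective : List (Var × Agent) → Fm → Set
  Introspective xs φ = ⊢ assign xs (φ ⇒ K (vars xs) (assign xs φ))

  closed-assign-¬K : ∀ xs {α} → Closed (assign xs (¬' K (vars xs) α))
  closed-assign-¬K xs = closed-assign xs λ { y (f¬ (fK y∈xs)) → y∈xs }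

  ¬K-introspective : ∀ xs {α} → Unique (vars xs) → WF α → Closed α →
                     Introspective xs (¬' K (vars xs) α)
  ¬K-introspective xs {α} uniq wα cα =
    ax (ax-neg uniq) (wf-assign xs (wf-⇒ w¬K (wK (wf-assign xs w¬K) (closed-assign-¬K xs))))
    where
    w¬K : WF (¬' K (vars xs) α)
    w¬K = w¬ (wK wα cα)

  assign-K-T : ∀ xs X {φ} → WF φ → FreeVars⊆ φ (vars xs) →
               ⊢ assign xs (K X (assign xs φ) ⇒ φ)
  assign-K-T xs X wφ fv =
    assign-⇒-trans xs (assign-gen xs (K-T (wf-assign xs wφ) (closed-assign xs fv)))
                      (assign-T xs (closed-assign xs fv) wφ)

  K-assign-mono : ∀ xs X {φ ψ} → Closed (assign xs φ) → Closed (assign xs ψ) →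
                  ⊢ assign xs (φ ⇒ ψ) → ⊢ (K X (assign xs φ) ⇒ K X (assign xs ψ))
  K-assign-mono xs X cφ cψ d = K-mono X cφ cψ (assign-⇒-distrib xs d)

  ¬-introspective : ∀ xs {φ} → Unique (vars xs) → WF φ → FreeVars⊆ φ (vars xs) →
                    Introspective xs φ → Introspective xs (¬' φ)
  ¬-introspective xs {φ} uniq wφ fv φ-intro =
    assign-⇒-trans xs (assign-contrapose xs (assign-K-T xs (vars xs) wφ fv))
      (assign-⇒-trans xs (¬K-introspective xs uniq (wf-assign xs wφ) (closed-assign xs fv))
        (assign-gen xs (K-assign-mono xs (vars xs) (closed-assign-¬K xs)
                          (closed-assign xs λ { y (f¬ p) → fv y p })
                          (assign-contrapose xs φ-intro))))

  introspective-⇔ : ∀ xs {φ ψ} → FreeVars⊆ φ (vars xs) → FreeVars⊆ ψ (vars xs) →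
                    ⊢ (φ ⇒ ψ) → ⊢ (ψ ⇒ φ) → Introspective xs φ → Introspective xs ψ
  introspective-⇔ xs fvφ fvψ φ⇒ψ ψ⇒φ φ-intro =
    assign-⇒-trans xs (assign-gen xs ψ⇒φ)
      (assign-⇒-trans xs φ-intro
        (assign-gen xs (K-mono (vars xs) (closed-assign xs fvφ) (closed-assign xs fvψ)
                          (assign-mono xs φ⇒ψ))))

  -- K β is equivalent to ¬¬K β, which is introspective by ¬-introspective applied to the axiom for ¬K β.
  K-introspective : ∀ xs {β} → Unique (vars xs) → WF β → Closed β → Introspective xs (K (vars xs) β)
  K-introspective xs {β} uniq wβ cβ =
    introspective-⇔ xs (λ { y (f¬ (f¬ (fK m))) → m }) (λ { y (fK m) → m })
      (tautology (¬ᵖ ¬ᵖ p₀ ⇒ᵖ p₀) (Kβ ∷ []) (wf-⇒ (w¬ w¬K) wKβ))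
      (tautology (p₀ ⇒ᵖ ¬ᵖ ¬ᵖ p₀) (Kβ ∷ []) (wf-⇒ wKβ (w¬ w¬K)))
      (¬-introspective xs uniq w¬K (λ { y (f¬ (fK m)) → m }) (¬K-introspective xs uniq wβ cβ))
    where
    Kβ : Fm
    Kβ = K (vars xs) β
    wKβ : WF Kβ
    wKβ = wK wβ cβ
    w¬K : WF (¬' Kβ)
    w¬K = w¬ wKβ

  ∧-introspective : ∀ xs {φ ψ} → WF φ → WF ψ → FreeVars⊆ φ (vars xs) → FreeVars⊆ ψ (vars xs) →
                    Introspective xs φ → Introspective xs ψ → Introspective xs (φ ∧' ψ)
  ∧-introspective xs {φ} {ψ} wφ wψ fvφ fvψ φ-intro ψ-intro =
    assign-⇒-trans xs
      (assign-taut₂ xs (p₀ ⇒ᵖ p₁) (p₂ ⇒ᵖ p₃) (p₀ ∧ᵖ p₂ ⇒ᵖ p₁ ∧ᵖ p₃) (φ ∷ KAφ ∷ ψ ∷ KAψ ∷ [])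
        (wf-⇒ (w∧ wφ wψ) (w∧ wKφ wKψ)) φ-intro ψ-intro)
      (assign-gen xs
        (taut₁ (p₀ ⇒ᵖ p₁ ⇒ᵖ p₂) (p₀ ∧ᵖ p₁ ⇒ᵖ p₂) (KAφ ∷ KAψ ∷ K X (A (φ ∧' ψ)) ∷ [])
          (wf-⇒ (w∧ wKφ wKψ) (wK (wf-assign xs (w∧ wφ wψ)) c∧))
          (K-mono₂ X cφ cψ c∧ (assign-mono₂ xs
            (tautology (p₀ ⇒ᵖ p₁ ⇒ᵖ p₀ ∧ᵖ p₁) (φ ∷ ψ ∷ []) (wf-⇒ wφ (wf-⇒ wψ (w∧ wφ wψ))))))))
    where
    X : List Var
    X = vars xs
    A : Fm → Fm
    A = assign xs
    KAφ KAψ : Fm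
    KAφ = K X (A φ)
    KAψ = K X (A ψ)
    cφ : Closed (A φ)
    cφ = closed-assign xs fvφ
    cψ : Closed (A ψ)
    cψ = closed-assign xs fvψ
    c∧ : Closed (A (φ ∧' ψ))
    c∧ = closed-assign xs λ { y (f∧l p) → fvφ y p ; y (f∧r p) → fvψ y p }
    wKφ : WF KAφ
    wKφ = wK (wf-assign xs wφ) cφ
    wKψ : WF KAψ
    wKψ = wK (wf-assign xs wψ) cψ

  chi-wf : ∀ {x χ} → IsChi x χ → WF χ
  chi-wf χP = wP
  chi-wf (χK wα cα) = wK wα cα
  chi-wf (χ¬ h) = w¬ (chi-wf h)
  chi-wf (χ∧ h h') = w∧ (chi-wf h) (chi-wf h')

  chi-free : ∀ {x χ} → IsChi x χ → FreeVars⊆ χ (x ∷ [])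
  chi-free χP y fP = here refl
  chi-free (χK _ _) y (fK y∈x) = y∈x
  chi-free (χ¬ h) y (f¬ p) = chi-free h y p
  chi-free (χ∧ h h') y (f∧l p) = chi-free h y p
  chi-free (χ∧ h h') y (f∧r p) = chi-free h' y p

  chi-introspective : ∀ {x χ} → IsChi x χ → ∀ a → Introspective ((x , a) ∷ []) χ
  chi-introspective χP a =
    ax ax-atom (w≔ (wf-⇒ wP (wK (w≔ wP) (closed-assign (_ ∷ []) (chi-free χP)))))
  chi-introspective (χK wα cα) a = K-introspective (_ ∷ []) ([] ∷ []) wα cα
  chi-introspective (χ¬ h) a =
    ¬-introspective (_ ∷ []) ([] ∷ []) (chi-wf h) (chi-free h) (chi-introspective h a)
  chi-introspective (χ∧ h h') a =
    ∧-introspective (_ ∷ []) (chi-wf h) (chi-wf h') (chi-free h) (chi-free h')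
      (chi-introspective h a) (chi-introspective h' a)

  box-diamond : ∀ {x a φ} → WF φ → ⊢ ([ x ≔ a ] φ ⇒ (⟨ x ≔ a ⟩ tt ⇒ ⟨ x ≔ a ⟩ φ))
  box-diamond {x} {a} {φ} wφ =
    taut₁ (p₀ ⇒ᵖ p₁ ⇒ᵖ p₂) (p₀ ⇒ᵖ ¬ᵖ p₂ ⇒ᵖ ¬ᵖ p₁)
      ([ x ≔ a ] φ ∷ [ x ≔ a ] (¬' φ) ∷ [ x ≔ a ] (¬' tt) ∷ [])
      (wf-⇒ (w≔ wφ) (wf-⇒ (w¬ (w≔ (w¬ wtt))) (w¬ (w≔ (w¬ wφ)))))
      (assign-mono₂ ((x , a) ∷ [])
        (tautology (p₀ ⇒ᵖ ¬ᵖ p₀ ⇒ᵖ ¬ᵖ p₁) (φ ∷ tt ∷ []) (wf-⇒ wφ (wf-⇒ (w¬ wφ) (w¬ wtt)))))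

  -- The axiom [x:=a] K_x ⟨x:=a⟩⊤ lets K_x pass from [x:=a]φ to ⟨x:=a⟩φ.
  diamond-introspective : ∀ {x a φ} → WF φ → FreeVars⊆ φ (x ∷ []) → Introspective ((x , a) ∷ []) φ →
                          ⊢ (⟨ x ≔ a ⟩ φ ⇒ [ x ≔ a ] K (x ∷ []) (⟨ x ≔ a ⟩ φ))
  diamond-introspective {x} {a} {φ} wφ fv φ-intro =
    ⇒-trans (ax ax-func (wf-⇒ w◇φ (w≔ wφ)))
      (⇒-trans (assign-⇒-distrib ((x , a) ∷ []) φ-intro)
        (⇒-mp (assign-mono₂ ((x , a) ∷ []) (K-mono₂ (x ∷ []) c□φ c◇tt c◇φ (box-diamond wφ)))
              (ax ax-ex (w≔ (wK w◇tt c◇tt)))))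
    where
    w◇φ : WF (⟨ x ≔ a ⟩ φ)
    w◇φ = w¬ (w≔ (w¬ wφ))
    w◇tt : WF (⟨ x ≔ a ⟩ tt)
    w◇tt = w¬ (w≔ (w¬ wtt))
    c□φ : Closed ([ x ≔ a ] φ)
    c□φ = closed-assign ((x , a) ∷ []) fv
    c◇φ : Closed (⟨ x ≔ a ⟩ φ)
    c◇φ = closed-¬ (closed-assign ((x , a) ∷ []) λ { y (f¬ p) → fv y p })
    c◇tt : Closed (⟨ x ≔ a ⟩ tt)
    c◇tt = closed-¬ (closed-assign ((x , a) ∷ []) λ { y (f¬ ()) })

  K-rename : ∀ {x y a θ} → Closed θ → WF θ → ⊢ ([ x ≔ a ] K (x ∷ []) θ ⇒ [ y ≔ a ] K (y ∷ []) θ)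
  K-rename {x} {y} {a} {θ} cθ wθ =
    ⇒-trans (assign-vacuous ((y , a) ∷ []) (closed-assign-K ((x , a) ∷ []) cθ) (w≔ wKθ))
      (assign-⇒-distrib ((y , a) ∷ [])
          (subst (λ z → ⊢ [ y ≔ a ] ([ x ≔ a ] K (x ∷ []) θ ⇒ K (z ∷ []) θ)) (rn-hit y x)
                 (substitution _ wKθ)))
    where
    wKθ : ∀ {X} → WF (K X θ)
    wKθ = wK wθ cθ

  -- Renaming the bound variables of assignments

  numbered : ℕ → List Agent → List (Var × Agent)
  numbered o [] = []
  numbered o (a ∷ T) = (o , a) ∷ numbered (suc o) T

  assignK : ℕ → List Agent → List Var → Fm → Fm
  assignK o T V α = assign (numbered o T) (K V α)

  Bounded : ℕ → List Var → Set
  Bounded m V = ∀ v → v ∈ V → v < m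

  Covering : ℕ → List Var → Set
  Covering m W = ∀ v → v < m → v ∈ W

  numbered-bounded : ∀ o T → Bounded (o + length T) (vars (numbered o T))
  numbered-bounded o (a ∷ T) v v∈ = subst (v <_) (sym (+-suc o (length T))) (bound v∈)
    where
    bound : v ∈ vars (numbered o (a ∷ T)) → v < suc o + length T
    bound (here refl) = s≤s (m≤m+n o (length T))
    bound (there v∈) = numbered-bounded (suc o) T v v∈

  numbered-covering : ∀ o T {v} → o ≤ v → v < o + length T → v ∈ vars (numbered o T)
  numbered-covering o [] {v} o≤v v<o+0 = ⊥-elim (<-irrefl refl (≤-<-trans o≤v (subst (v <_) (+-identityʳ o) v<o+0)))
  numbered-covering o (a ∷ T) {v} o≤v v< with m≤n⇒m<n∨m≡n o≤v
  ... | inj₂ refl = here refl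
  ... | inj₁ o<v = there (numbered-covering (suc o) T o<v (subst (v <_) (+-suc o (length T)) v<))

  numbered-fresh : ∀ c o T → c < o → All (_≢ c) (vars (numbered o T))
  numbered-fresh c o [] c<o = []
  numbered-fresh c o (a ∷ T) c<o = (λ o≡c → <-irrefl (sym o≡c) c<o) ∷ numbered-fresh c (suc o) T (m<n⇒m<1+n c<o)

  numbered-unique : ∀ o T → Unique (vars (numbered o T))
  numbered-unique o [] = []
  numbered-unique o (a ∷ T) = All.map (λ v≢o o≡v → v≢o (sym o≡v)) (numbered-fresh o (suc o) T (n<1+n o))
                              ∷ numbered-unique (suc o) T

  wf-assignK : ∀ {α} → WF α → Closed α → ∀ o T V → WF (assignK o T V α)
  wf-assignK wα cα o T V = wf-assign (numbered o T) (wK wα cα)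

  free-assignK : ∀ {α o T V y} → FreeIn y (assignK o T V α) → y ∈ V
  free-assignK {o = o} {T} p with free-assign⁻ (numbered o T) p
  ... | fK y∈V , _ = y∈V

  sub-assignK : ∀ y x zs {V α} → All (_≢ x) (vars zs) →
                sub y x (assign zs (K V α)) ≡ assign zs (K (map (rn y x) V) α)
  sub-assignK y x [] [] = refl
  sub-assignK y x ((z , b) ∷ zs) (z≢x ∷ zs≢x) with z ≡ᵇ x in eq
  ... | true = ⊥-elim (z≢x (≡ᵇ-true eq))
  ... | false = cong [ z ≔ b ]_ (sub-assignK y x zs zs≢x)

  adm-assignK : ∀ y x zs {V α} → All (_≢ y) (vars zs) → Adm y x (assign zs (K V α))
  adm-assignK y x [] [] = _
  adm-assignK y x ((z , b) ∷ zs) (z≢y ∷ zs≢y) with z ≡ᵇ x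
  ... | true = _
  ... | false = (λ z≡y → ⊥-elim (z≢y z≡y)) , adm-assignK y x zs zs≢y

  punchIn : ℕ → ℕ → ℕ
  punchIn o v with v <? o
  ... | yes _ = v
  ... | no _ = suc v

  punchIn-< : ∀ {o v} → v < o → punchIn o v ≡ v
  punchIn-< {o} {v} v<o with v <? o
  ... | yes _ = refl
  ... | no v≮o = ⊥-elim (v≮o v<o)

  punchIn-≮ : ∀ {o v} → ¬ v < o → punchIn o v ≡ suc v
  punchIn-≮ {o} {v} v≮o with v <? o
  ... | yes v<o = ⊥-elim (v≮o v<o)
  ... | no _ = refl

  punchIn-≢ : ∀ o v → punchIn o v ≢ o
  punchIn-≢ o v with v <? o
  ... | yes v<o = λ v≡o → <-irrefl v≡o v<o
  ... | no v≮o = λ v+1≡o → v≮o (subst (v <_) v+1≡o (n<1+n v))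

  punchIn-bounded : ∀ {o m v} → v < o + m → punchIn o v < suc (o + m)
  punchIn-bounded {o} {m} {v} v< with v <? o
  ... | yes _ = m<n⇒m<1+n v<
  ... | no _ = s≤s v<

  rn-punchIn : ∀ o v → rn (suc o) o (punchIn (suc o) v) ≡ punchIn o v
  rn-punchIn o v with <-cmp v o
  ... | tri< v<o _ _ =
    trans (cong (rn (suc o) o) (punchIn-< (m<n⇒m<1+n v<o)))
          (trans (rn-miss (suc o) o v (<⇒≢ v<o)) (sym (punchIn-< v<o)))
  ... | tri≈ _ refl _ =
    trans (cong (rn (suc o) o) (punchIn-< (n<1+n v)))
          (trans (rn-hit (suc o) o) (sym (punchIn-≮ (<-irrefl refl))))
  ... | tri> _ _ o<v =
    trans (cong (rn (suc o) o) (punchIn-≮ (λ v<o+1 → <-irrefl refl (<-≤-trans o<v (≤-pred v<o+1)))))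
          (trans (rn-miss (suc o) o (suc v) (λ v+1≡o → <-irrefl refl (<-trans o<v (subst (v <_) v+1≡o (n<1+n v)))))
                 (sym (punchIn-≮ (λ v<o → <-irrefl refl (<-trans o<v v<o)))))

  bounded-step : ∀ o m {V} → Bounded (o + suc m) V → Bounded (suc o + m) V
  bounded-step o m bounded v v∈V = subst (v <_) (+-suc o m) (bounded v v∈V)

  covering-step : ∀ o m {W} → Covering (o + suc m) W → Covering (suc o + m) W
  covering-step o m covering v v< = covering v (subst (v <_) (sym (+-suc o m)) v<)

  -- Renaming the bound variables o, o+1, … to o+1, o+2, …, one at a time from the innermost,
  -- with the free variables of K punched accordingly.
  assignK-shift : ∀ {α} → WF α → Closed α → ∀ T o V → Bounded (o + length T) V →
                  ⊢ (assignK o T V α ⇒ assignK (suc o) T (map (punchIn o) V) α)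
  assignK-shift wα cα [] o V bounded = K-⊆ V⊆ wα cα
    where
    V⊆ : V ⊆ map (punchIn o) V
    V⊆ {v} v∈V = subst (_∈ map (punchIn o) V)
                       (punchIn-< (subst (v <_) (+-identityʳ o) (bounded v v∈V)))
                       (∈-map⁺ (punchIn o) v∈V)
  assignK-shift {α} wα cα (a ∷ T) o V bounded =
    ⇒-trans (assign-mono ((o , a) ∷ []) (assignK-shift wα cα T (suc o) V (bounded-step o (length T) bounded)))
      (⇒-trans (vacuous o+1-not-free (w≔ wΦ))
               (assign-⇒-distrib ((suc o , a) ∷ []) renamed))
    where
    Φ : Fm
    Φ = assignK (suc (suc o)) T (map (punchIn (suc o)) V) α
    wΦ : WF Φ
    wΦ = wf-assignK wα cα (suc (suc o)) T (map (punchIn (suc o)) V)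
    o+1-not-free : ¬ FreeIn (suc o) ([ o ≔ a ] Φ)
    o+1-not-free (f≔ _ p) with ∈-map⁻ (punchIn (suc o)) (free-assignK p)
    ... | v , _ , o+1≡ = punchIn-≢ (suc o) v (sym o+1≡)
    renamed-vars : map (rn (suc o) o) (map (punchIn (suc o)) V) ≡ map (punchIn o) V
    renamed-vars = trans (sym (map-∘ V)) (map-cong (rn-punchIn o) V)
    sub-Φ : sub (suc o) o Φ ≡ assignK (suc (suc o)) T (map (punchIn o) V) α
    sub-Φ = trans (sub-assignK (suc o) o (numbered (suc (suc o)) T)
                    (numbered-fresh o (suc (suc o)) T (m<n⇒m<1+n (n<1+n o))))
                  (cong (λ U → assignK (suc (suc o)) T U α) renamed-vars)
    renamed : ⊢ [ suc o ≔ a ] ([ o ≔ a ] Φ ⇒ assignK (suc (suc o)) T (map (punchIn o) V) α)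
    renamed = subst (λ ψ → ⊢ [ suc o ≔ a ] ([ o ≔ a ] Φ ⇒ ψ)) sub-Φ
                (substitution (adm-assignK (suc o) o (numbered (suc (suc o)) T)
                                (numbered-fresh (suc o) (suc (suc o)) T (n<1+n (suc o))))
                              wΦ)

  assignK-⊑ : ∀ {α} → WF α → Closed α → ∀ {T T'} → T ⊑ T' → ∀ o V W →
              Bounded (o + length T) V → Covering (o + length T') W →
              ⊢ (assignK o T V α ⇒ assignK o T' W α)
  assignK-⊑ wα cα [] o V W bounded covering = K-⊆ (λ {v} v∈V → covering v (bounded v v∈V)) wα cα
  assignK-⊑ {α} wα cα (_∷ʳ_ {xs = T} {ys = T'} b T⊑T') o V W bounded covering =
    ⇒-trans (assignK-shift wα cα T o V bounded)
      (⇒-trans (vacuous o-not-free (wf-assignK wα cα (suc o) T V'))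
        (assign-mono ((o , b) ∷ [])
          (assignK-⊑ wα cα T⊑T' (suc o) V' W bounded' (covering-step o (length T') covering))))
    where
    V' : List Var
    V' = map (punchIn o) V
    o-not-free : ¬ FreeIn o (assignK (suc o) T V' α)
    o-not-free p with ∈-map⁻ (punchIn o) (free-assignK p)
    ... | v , _ , o≡ = punchIn-≢ o v (sym o≡)
    bounded' : Bounded (suc o + length T) V'
    bounded' v v∈V' with ∈-map⁻ (punchIn o) v∈V'
    ... | u , u∈V , refl = punchIn-bounded (bounded u u∈V)
  assignK-⊑ wα cα (_∷_ {xs = T} {ys = T'} refl T⊑T') o V W bounded covering =
    assign-mono ((o , _) ∷ [])
      (assignK-⊑ wα cα T⊑T' (suc o) V W (bounded-step o (length T) bounded)
                                        (covering-step o (length T') covering))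

  -- The operator K_χ

  wf-⋀ : ∀ {A : Set} {f : A → Fm} L → (∀ p → WF (f p)) → WF (⋀ (map f L))
  wf-⋀ [] wf = wtt
  wf-⋀ (p ∷ L) wf = w∧ (wf p) (wf-⋀ L wf)

  closed-⋀ : ∀ {A : Set} {f : A → Fm} L → (∀ p → Closed (f p)) → Closed (⋀ (map f L))
  closed-⋀ [] cf = closed-tt
  closed-⋀ (p ∷ L) cf = closed-∧ (cf p) (closed-⋀ L cf)

  ⋀-elim : ∀ {A : Set} {f : A → Fm} {L p} → (∀ q → WF (f q)) → p ∈ L → ⊢ (⋀ (map f L) ⇒ f p)
  ⋀-elim {L = q ∷ L} wf (here refl) = ∧-projˡ (wf q) (wf-⋀ L wf)
  ⋀-elim {L = q ∷ L} wf (there p∈L) = ⇒-trans (∧-projʳ (wf q) (wf-⋀ L wf)) (⋀-elim wf p∈L)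

  ⇒-⋀-intro : ∀ {A : Set} {f : A → Fm} {C} L → WF C → (∀ p → p ∈ L → ⊢ (C ⇒ f p)) →
              ⊢ (C ⇒ ⋀ (map f L))
  ⇒-⋀-intro [] wC _ = ⇒-weaken wC ⊢tt
  ⇒-⋀-intro (p ∷ L) wC h = ⇒-∧-intro (h p (here refl)) (⇒-⋀-intro L wC λ q q∈L → h q (there q∈L))

  ⇒-assign-K-⋀ : ∀ xs X {A : Set} {f : A → Fm} {C} L → WF C → (∀ p → WF (f p)) → (∀ p → Closed (f p)) →
                 (∀ p → p ∈ L → ⊢ (C ⇒ assign xs (K X (f p)))) → ⊢ (C ⇒ assign xs (K X (⋀ (map f L))))
  ⇒-assign-K-⋀ xs X [] wC wf cf h = ⇒-weaken wC (assign-gen xs (K-nec X closed-tt ⊢tt))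
  ⇒-assign-K-⋀ xs X {f = f} {C} (p ∷ L) wC wf cf h =
    taut₃ (p₀ ⇒ᵖ p₁) (p₀ ⇒ᵖ p₂) (p₁ ⇒ᵖ p₂ ⇒ᵖ p₃) (p₀ ⇒ᵖ p₃)
      (C ∷ □ (f p) ∷ □ (⋀ (map f L)) ∷ □ (⋀ (map f (p ∷ L))) ∷ [])
      (wf-⇒ wC (wf-assign xs (wK (wf-⋀ (p ∷ L) wf) (closed-⋀ (p ∷ L) cf))))
      (h p (here refl))
      (⇒-assign-K-⋀ xs X L wC wf cf λ q q∈L → h q (there q∈L))
      (assign-mono₂ xs (K-mono₂ X (cf p) (closed-⋀ L cf) (closed-⋀ (p ∷ L) cf)
        (tautology (p₀ ⇒ᵖ p₁ ⇒ᵖ p₀ ∧ᵖ p₁) (f p ∷ ⋀ (map f L) ∷ [])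
                   (wf-⇒ (wf p) (wf-⇒ (wf-⋀ L wf) (wf-⋀ (p ∷ L) wf))))))
    where
    □ : Fm → Fm
    □ φ = assign xs (K X φ)

  splits-∈⁻ : ∀ {A : Set} (a : A) L {S B} → (S , B) ∈ splits (a ∷ L) →
              (∃ λ S₀ → S ≡ a ∷ S₀ × (S₀ , B) ∈ splits L) ⊎ (∃ λ B₀ → B ≡ a ∷ B₀ × (S , B₀) ∈ splits L)
  splits-∈⁻ a L m with ∈-++⁻ (map (λ p → (a ∷ proj₁ p , proj₂ p)) (splits L)) m
  ... | inj₁ m₁ with ∈-map⁻ (λ p → (a ∷ proj₁ p , proj₂ p)) m₁
  ...   | (S₀ , B₀) , m₀ , refl = inj₁ (S₀ , refl , m₀)
  splits-∈⁻ a L m | inj₂ m₂ with ∈-map⁻ (λ p → (proj₁ p , a ∷ proj₂ p)) m₂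
  ...   | (S₀ , B₀) , m₀ , refl = inj₂ (B₀ , refl , m₀)

  splits-⊑⊎clash : ∀ {A : Set} L {S B S' B' : List A} → (S , B) ∈ splits L → (S' , B') ∈ splits L →
                   S ⊑ S' ⊎ ∃ λ a → a ∈ S × a ∈ B'
  splits-⊑⊎clash [] (here refl) (here refl) = inj₁ []
  splits-⊑⊎clash (a ∷ L) m m' with splits-∈⁻ a L m | splits-∈⁻ a L m'
  ... | inj₁ (_ , refl , m₀) | inj₁ (_ , refl , m₀') with splits-⊑⊎clash L m₀ m₀'
  ...   | inj₁ S⊑S' = inj₁ (refl ∷ S⊑S')
  ...   | inj₂ (b , b∈S , b∈B') = inj₂ (b , there b∈S , b∈B')
  splits-⊑⊎clash (a ∷ L) m m' | inj₁ (_ , refl , _) | inj₂ (_ , refl , _) = inj₂ (a , here refl , here refl)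
  splits-⊑⊎clash (a ∷ L) m m' | inj₂ (_ , refl , m₀) | inj₁ (_ , refl , m₀') with splits-⊑⊎clash L m₀ m₀'
  ...   | inj₁ S⊑S' = inj₁ (a ∷ʳ S⊑S')
  ...   | inj₂ clash = inj₂ clash
  splits-⊑⊎clash (a ∷ L) m m' | inj₂ (_ , refl , m₀) | inj₂ (_ , refl , m₀') with splits-⊑⊎clash L m₀ m₀'
  ...   | inj₁ S⊑S' = inj₁ S⊑S'
  ...   | inj₂ (b , b∈S , b∈B') = inj₂ (b , b∈S , there b∈B')

  zip-applyUpTo : ∀ (f : ℕ → ℕ) o S → (∀ i → f i ≡ o + i) → zip (applyUpTo f (length S)) S ≡ numbered o S
  zip-applyUpTo f o [] _ = refl
  zip-applyUpTo f o (a ∷ S) f≡o+ =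
    cong₂ _∷_ (cong (_, a) (trans (f≡o+ 0) (+-identityʳ o)))
              (zip-applyUpTo (λ i → f (suc i)) (suc o) S λ i → trans (f≡o+ (suc i)) (+-suc o i))

  indices : List Agent → List Var
  indices S = vars (numbered 0 S)

  indices-covering : ∀ S → Covering (0 + length S) (indices S)
  indices-covering S v v<|S| = numbered-covering 0 S z≤n v<|S|

  module _ (x : Var) {χ : Fm} (χ-chi : IsChi x χ) where

    ◇χ : Agent → Fm
    ◇χ a = ⟨ x ≔ a ⟩ χ

    □¬χ : Agent → Fm
    □¬χ b = [ x ≔ b ] (¬' χ)

    ◇⋀ : List Agent → Fm
    ◇⋀ S = ⋀ (map ◇χ S)

    Kχ-clause : Fm → List Agent × List Agent → Fm
    Kχ-clause α (S , B) = bang x χ S B ⇒ assignK 0 S (indices S) α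

    Kχ-clauses : ∀ α → Kφ x χ α ≡ ⋀ (map (Kχ-clause α) (splits allAgents))
    Kχ-clauses α = cong ⋀ (map-cong (λ { (S , B) → clause≡ S B }) (splits allAgents))
      where
      clause≡ : ∀ S B → (bang x χ S B ⇒ assign (zip (upTo (length S)) S) (K (vars (zip (upTo (length S)) S)) α))
                        ≡ Kχ-clause α (S , B)
      clause≡ S B = cong (λ xs → bang x χ S B ⇒ assign xs (K (vars xs) α))
                         (zip-applyUpTo (λ i → i) 0 S λ _ → refl)

    w◇χ : ∀ a → WF (◇χ a)
    w◇χ a = w¬ (w≔ (w¬ (chi-wf χ-chi)))

    c◇χ : ∀ a → Closed (◇χ a)
    c◇χ a y (f¬ (f≔ y≢x (f¬ p))) with chi-free χ-chi y p
    ... | here y≡x = y≢x y≡x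

    w□¬χ : ∀ b → WF (□¬χ b)
    w□¬χ b = w≔ (w¬ (chi-wf χ-chi))

    c□¬χ : ∀ b → Closed (□¬χ b)
    c□¬χ b y (f≔ y≢x (f¬ p)) with chi-free χ-chi y p
    ... | here y≡x = y≢x y≡x

    w-bang : ∀ S B → WF (bang x χ S B)
    w-bang S B = w∧ (wf-⋀ S w◇χ) (wf-⋀ B w□¬χ)

    c-bang : ∀ S B → Closed (bang x χ S B)
    c-bang S B = closed-∧ (closed-⋀ S c◇χ) (closed-⋀ B c□¬χ)

    module _ {α} (wα : WF α) (cα : Closed α) where

      wf-Kχ : WF (Kφ x χ α)
      wf-Kχ = subst WF (sym (Kχ-clauses α))
        (wf-⋀ (splits allAgents) λ { (S , B) → wf-⇒ (w-bang S B) (wf-assignK wα cα 0 S (indices S)) })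

      closed-Kχ : Closed (Kφ x χ α)
      closed-Kχ = subst Closed (sym (Kχ-clauses α))
        (closed-⋀ (splits allAgents) λ { (S , B) → closed-⇒ (c-bang S B) (closed-assign-K (numbered 0 S) cα) })

      Kχ-elim : ∀ {S B} → (S , B) ∈ splits allAgents → ⊢ (Kφ x χ α ⇒ Kχ-clause α (S , B))
      Kχ-elim m = subst (λ φ → ⊢ (φ ⇒ Kχ-clause α _)) (sym (Kχ-clauses α))
        (⋀-elim (λ { (S , B) → wf-⇒ (w-bang S B) (wf-assignK wα cα 0 S (indices S)) }) m)

      Kχ-intro : ∀ {C} → WF C → (∀ {S B} → (S , B) ∈ splits allAgents → ⊢ (C ⇒ Kχ-clause α (S , B))) →
                 ⊢ (C ⇒ Kφ x χ α)
      Kχ-intro wC h = subst (λ φ → ⊢ (_ ⇒ φ)) (sym (Kχ-clauses α))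
        (⇒-⋀-intro (splits allAgents) wC λ { (S , B) m → h m })

    ◇χ-known : ∀ {S a} → a ∈ S → ⊢ (◇χ a ⇒ assignK 0 S (indices S) (◇χ a))
    ◇χ-known {S} {a} a∈S =
      ⇒-trans (diamond-introspective (chi-wf χ-chi) (chi-free χ-chi) (chi-introspective χ-chi a))
        (⇒-trans (K-rename (c◇χ a) (w◇χ a))
          (assignK-⊑ (w◇χ a) (c◇χ a) (from∈ a∈S) 0 (0 ∷ []) (indices S)
                     (λ { v (here refl) → s≤s z≤n }) (indices-covering S)))

    ◇⋀-known : ∀ S → ⊢ (◇⋀ S ⇒ assignK 0 S (indices S) (◇⋀ S))
    ◇⋀-known S = ⇒-assign-K-⋀ (numbered 0 S) (indices S) S (wf-⋀ S w◇χ) w◇χ c◇χ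
      λ a a∈S → ⇒-trans (⋀-elim w◇χ a∈S) (◇χ-known a∈S)

    module _ {β} (wβ : WF β) (cβ : Closed β) where

      Kχβ : Fm
      Kχβ = Kφ x χ β

      known : List Agent → Fm
      known S = assignK 0 S (indices S) β

      w-known : ∀ S → WF (known S)
      w-known S = wf-assignK wβ cβ 0 S (indices S)

      c-known : ∀ S → Closed (known S)
      c-known S = closed-assign-K (numbered 0 S) cβ

      known-introspective : ∀ S → ⊢ (known S ⇒ assignK 0 S (indices S) (known S))
      known-introspective S =
        assign-⇒-distrib (numbered 0 S) (K-introspective (numbered 0 S) (numbered-unique 0 S) wβ cβ)

      -- Every clause of K_χ β with antecedent χ!(S',B') follows: either S ⊑ S' and the knowledge
      -- transfers, or some a ∈ S has a ∈ B', and then ⟨x:=a⟩χ contradicts [x:=a]¬χ.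
      ◇⋀∧known⇒Kχ : ∀ {S B} → (S , B) ∈ splits allAgents → ⊢ ((◇⋀ S ∧' known S) ⇒ Kχβ)
      ◇⋀∧known⇒Kχ {S} m = Kχ-intro wβ cβ (w∧ (wf-⋀ S w◇χ) (w-known S)) clause
        where
        clause : ∀ {S' B'} → (S' , B') ∈ splits allAgents → ⊢ ((◇⋀ S ∧' known S) ⇒ Kχ-clause β (S' , B'))
        clause {S'} {B'} m' with splits-⊑⊎clash allAgents m m'
        ... | inj₁ S⊑S' =
          taut₁ (p₁ ⇒ᵖ p₂) (p₀ ∧ᵖ p₁ ⇒ᵖ p₃ ⇒ᵖ p₂) (◇⋀ S ∷ known S ∷ known S' ∷ bang x χ S' B' ∷ [])
            (wf-⇒ (w∧ (wf-⋀ S w◇χ) (w-known S)) (wf-⇒ (w-bang S' B') (w-known S')))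
            (assignK-⊑ wβ cβ S⊑S' 0 (indices S) (indices S') (numbered-bounded 0 S) (indices-covering S'))
        ... | inj₂ (a , a∈S , a∈B') =
          taut₂ (p₀ ⇒ᵖ ¬ᵖ p₁) (p₂ ⇒ᵖ p₁) (p₀ ∧ᵖ p₃ ⇒ᵖ p₂ ⇒ᵖ p₄)
            (◇⋀ S ∷ □¬χ a ∷ bang x χ S' B' ∷ known S ∷ known S' ∷ [])
            (wf-⇒ (w∧ (wf-⋀ S w◇χ) (w-known S)) (wf-⇒ (w-bang S' B') (w-known S')))
            (⋀-elim w◇χ a∈S)
            (⇒-trans (∧-projʳ (wf-⋀ S' w◇χ) (wf-⋀ B' w□¬χ)) (⋀-elim w□¬χ a∈B'))

      Kχ⇒Kχ-clause : ∀ {S B} → (S , B) ∈ splits allAgents → ⊢ (Kχβ ⇒ Kχ-clause Kχβ (S , B))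
      Kχ⇒Kχ-clause {S} {B} m =
        taut₃ (p₀ ⇒ᵖ p₁ ⇒ᵖ p₂) (p₁ ⇒ᵖ p₃) (p₃ ⇒ᵖ p₂ ⇒ᵖ p₄) (p₀ ⇒ᵖ p₁ ⇒ᵖ p₄)
          (Kχβ ∷ bang x χ S B ∷ □ (known S) ∷ □ (◇⋀ S) ∷ □ Kχβ ∷ [])
          (wf-⇒ (wf-Kχ wβ cβ) (wf-⇒ (w-bang S B) (wf-assignK (wf-Kχ wβ cβ) (closed-Kχ wβ cβ) 0 S (indices S))))
          (taut₂ (p₀ ⇒ᵖ p₁ ⇒ᵖ p₂) (p₂ ⇒ᵖ p₃) (p₀ ⇒ᵖ p₁ ⇒ᵖ p₃) (Kχβ ∷ bang x χ S B ∷ known S ∷ □ (known S) ∷ [])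
            (wf-⇒ (wf-Kχ wβ cβ) (wf-⇒ (w-bang S B) (wf-assignK (w-known S) (c-known S) 0 S (indices S))))
            (Kχ-elim wβ cβ m) (known-introspective S))
          (⇒-trans (∧-projˡ (wf-⋀ S w◇χ) (wf-⋀ B w□¬χ)) (◇⋀-known S))
          (assign-mono₂ (numbered 0 S) (K-mono₂ (indices S) (closed-⋀ S c◇χ) (c-known S) (closed-Kχ wβ cβ)
            (taut₁ (p₀ ∧ᵖ p₁ ⇒ᵖ p₂) (p₀ ⇒ᵖ p₁ ⇒ᵖ p₂) (◇⋀ S ∷ known S ∷ Kχβ ∷ [])
              (wf-⇒ (wf-⋀ S w◇χ) (wf-⇒ (w-known S) (wf-Kχ wβ cβ))) (◇⋀∧known⇒Kχ m))))
        where
        □ : Fm → Fm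
        □ φ = assignK 0 S (indices S) φ

      Kχ-positive-introspection : ⊢ (Kχβ ⇒ Kφ x χ Kχβ)
      Kχ-positive-introspection = Kχ-intro (wf-Kχ wβ cβ) (closed-Kχ wβ cβ) (wf-Kχ wβ cβ) Kχ⇒Kχ-clause

mainTheorem13 : (n : ℕ) (x : LEL.Var n) (χ β : LEL.Fm n) →
    LEL.IsChi n x χ → LEL.WF n β → LEL.Closed n β →
    LEL.⊢_ n (LEL._⇒_ n (LEL.Kφ n x χ β) (LEL.Kφ n x χ (LEL.Kφ n x χ β)))
mainTheorem13 n x χ β χ-chi wβ cβ = Kχ-positive-introspection n x χ-chi wβ cβ
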